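{- Let $G_1,G_2,\dots,G_k$ be finite simple graphs with pairwise disjoint vertex sets $V_i=V(G_i)$ and edge sets $E_i=E(G_i)$, $1\le i\le k$, none of which has a well-connected vertex. Then \[ C^\xi(G_1+G_2+\cdots+G_k) = \sum_{i=1}^k |E(G_i)| + \frac12\Big(\sum_{i=1}^k |V(G_i)|\Big)^2 - \frac12\sum_{i=1}^k |V(G_i)|^2 . \]
   Context: A vertex of a graph is well-connected if it is adjacent to all other vertices of the graph. The join $G_1+\cdots+G_k$ of graphs with pairwise disjoint vertex sets has vertex set $V_1\cup\cdots\cup V_k$ and edge set $E_1\cup\cdots\cup E_k$ together with all edges $xy$ with $x\in V_i$, $y\in V_j$, $i\neq j$. For a connected graph $H$, $d_H(v)$ is the degree of $v$, the eccentricity $\varepsilon_H(v)$ is the largest distance from $v$ to any other vertex, and the connective eccentric index is $C^\xi(H)=\sum_{v\in V(H)} \frac{d_H(v)}{\varepsilon_H(v)}$. -}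

module Defs where

open import Data.Bool using (Bool; true; false; _∧_; _∨_; if_then_else_)
open import Data.Nat as ℕ using (ℕ; zero; suc; _⊔_; _<ᵇ_)
open import Data.Fin using (Fin; zero; suc; toℕ; splitAt; _≟_)
open import Data.Sum using (inj₁; inj₂)
open import Data.Integer using (+_)
open import Data.Rational using (ℚ; _/_; 0ℚ; _+_)
open import Relation.Nullary using (¬_; does)
open import Relation.Binary.PropositionalEquality using (_≡_; _≢_)

record Graph : Set where
  field
    n      : ℕ
    adj    : Fin n → Fin n → Bool
    sym    : ∀ x y → adj x y ≡ adj y x
    irrefl : ∀ x → adj x x ≡ false
open Graph public

sumℕ : (n : ℕ) → (Fin n → ℕ) → ℕ
sumℕ zero    f = 0
sumℕ (suc n) f = f zero ℕ.+ sumℕ n (λ i → f (suc i))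

sumℚ : (n : ℕ) → (Fin n → ℚ) → ℚ
sumℚ zero    f = 0ℚ
sumℚ (suc n) f = f zero + sumℚ n (λ i → f (suc i))

anyFin : (n : ℕ) → (Fin n → Bool) → Bool
anyFin zero    f = false
anyFin (suc n) f = f zero ∨ anyFin n (λ i → f (suc i))

maxFin : (n : ℕ) → (Fin n → ℕ) → ℕ
maxFin zero    f = 0
maxFin (suc n) f = f zero ⊔ maxFin n (λ i → f (suc i))

b2n : Bool → ℕ
b2n true  = 1
b2n false = 0

∣V∣ : Graph → ℕ
∣V∣ G = n G

-- number of edges |E(G)|: unordered adjacent pairs {x,y}, counted once via toℕ x < toℕ y
∣E∣ : Graph → ℕ
∣E∣ G = sumℕ (n G) λ x → sumℕ (n G) λ y → b2n ((toℕ x <ᵇ toℕ y) ∧ adj G x y)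

deg : (G : Graph) → Fin (n G) → ℕ
deg G v = sumℕ (n G) λ y → b2n (adj G v y)

reach : (G : Graph) → ℕ → Fin (n G) → Fin (n G) → Bool
reach G zero    u v = does (u ≟ v)
reach G (suc l) u v = reach G l u v ∨ anyFin (n G) (λ w → reach G l u w ∧ adj G w v)

-- distance d_G(u,v): least l with reach G l u v, searched over l = 0,…,n-1
-- (any distance in a connected graph on n vertices is < n; returns n if unreachable)
dist : (G : Graph) → Fin (n G) → Fin (n G) → ℕ
dist G u v = go (n G) 0
  where
  go : ℕ → ℕ → ℕ
  go zero    l = l
  go (suc f) l = if reach G l u v then l else go f (suc l)

ecc : (G : Graph) → Fin (n G) → ℕ
ecc G v = maxFin (n G) (λ w → dist G v w)

-- d / e as a rational (e = 0 only for the one-vertex graph, where d = 0 too)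
frac : ℕ → ℕ → ℚ
frac d zero    = 0ℚ
frac d (suc e) = (+ d) / suc e

Cξ : Graph → ℚ
Cξ G = sumℚ (n G) (λ v → frac (deg G v) (ecc G v))

WellConnected : (G : Graph) → Fin (n G) → Set
WellConnected G x = ∀ y → y ≢ x → adj G x y ≡ true

-- binary join G₁ + G₂ on Fin (n₁ + n₂): first n₁ vertices are G₁, rest are G₂
joinAdj : (G H : Graph) → Fin (n G ℕ.+ n H) → Fin (n G ℕ.+ n H) → Bool
joinAdj G H x y with splitAt (n G) x | splitAt (n G) y
... | inj₁ a | inj₁ b = adj G a b
... | inj₂ a | inj₂ b = adj H a b
... | inj₁ _ | inj₂ _ = true
... | inj₂ _ | inj₁ _ = true

joinSym : (G H : Graph) → ∀ x y → joinAdj G H x y ≡ joinAdj G H y x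
joinSym G H x y with splitAt (n G) x | splitAt (n G) y
... | inj₁ a | inj₁ b = sym G a b
... | inj₂ a | inj₂ b = sym H a b
... | inj₁ _ | inj₂ _ = _≡_.refl
... | inj₂ _ | inj₁ _ = _≡_.refl

joinIrrefl : (G H : Graph) → ∀ x → joinAdj G H x x ≡ false
joinIrrefl G H x with splitAt (n G) x
... | inj₁ a = irrefl G a
... | inj₂ a = irrefl H a

_⊕_ : Graph → Graph → Graph
G ⊕ H = record { n = n G ℕ.+ n H ; adj = joinAdj G H ; sym = joinSym G H ; irrefl = joinIrrefl G H }

emptyGraph : Graph
emptyGraph = record { n = 0 ; adj = λ () ; sym = λ () ; irrefl = λ () }

joinAll : (k : ℕ) → (Fin k → Graph) → Graph
joinAll zero    G = emptyGraph
joinAll (suc k) G = G zero ⊕ joinAll k (λ i → G (suc i))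

module Submission where

-- In such a join every vertex has eccentricity exactly 2: any two
-- vertices are at distance ≤ 2 (through a vertex of another summand), and
-- every vertex has a non-neighbour inside its own summand.  Hence
-- C^ξ = Σ_v d(v)/2 = ½ Σ_v d(v), and the degree sum of the join is counted
-- by the handshake lemma plus the n_i n_j cross edges:
--     Σ_v d(v) + Σ_i n_i² = 2 Σ_i |E(G_i)| + (Σ_i n_i)².

open import Defs
open import Data.Nat using (ℕ; _≤_)
open import Data.Fin using (Fin)
open import Data.Integer using (+_)
open import Data.Rational using (ℚ; _+_; _-_; _*_; _/_)
open import Relation.Nullary using (¬_)
open import Relation.Binary.PropositionalEquality using (_≡_)

import Data.Nat as ℕ
open import Data.Nat using (zero; suc; z≤n; s≤s)
import Data.Nat.Properties as ℕP
open import Data.Nat.Tactic.RingSolver using (solve-∀)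
open import Data.Fin using (zero; suc; toℕ; _↑ˡ_; _↑ʳ_; splitAt; _≟_)
import Data.Fin.Properties as FinP
open import Data.Bool using (Bool; true; false; _∧_; _∨_; T)
import Data.Bool.Properties as BoolP
open import Data.Sum using (_⊎_; inj₁; inj₂)
open import Data.Product using (Σ-syntax; _,_; _×_)
open import Data.Empty using (⊥-elim)
open import Relation.Nullary using (Dec; does; yes; no; _⊎-dec_)
open import Relation.Binary using (tri<; tri≈; tri>)
open import Relation.Binary.PropositionalEquality
  using (refl; trans; cong; cong₂; subst; _≢_; module ≡-Reasoning)
  renaming (sym to ≡-sym)
import Data.Integer as ℤ
import Data.Integer.Properties as ℤP
import Data.Integer.Tactic.RingSolver as ℤSolver
open import Data.Rational using (toℚᵘ)
import Data.Rational.Properties as ℚP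
open import Data.Rational.Solver using (module +-*-Solver)
open import Data.Rational.Unnormalised using (mkℚᵘ; _≃_; *≡*)
import Data.Rational.Unnormalised.Properties as ℚᵘP

-- (1) Finite sums over Fin n

sum-cong : ∀ n {f g : Fin n → ℕ} → (∀ i → f i ≡ g i) → sumℕ n f ≡ sumℕ n g
sum-cong zero    f≡g = refl
sum-cong (suc n) f≡g = cong₂ ℕ._+_ (f≡g zero) (sum-cong n (λ i → f≡g (suc i)))

sum-+ : ∀ n (f g : Fin n → ℕ) → sumℕ n (λ i → f i ℕ.+ g i) ≡ sumℕ n f ℕ.+ sumℕ n g
sum-+ zero    f g = refl
sum-+ (suc n) f g =
  trans (cong (f zero ℕ.+ g zero ℕ.+_) (sum-+ n (λ i → f (suc i)) (λ i → g (suc i))))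
        (interchange (f zero) (g zero) _ _)
  where
  interchange : ∀ a b c d → (a ℕ.+ b) ℕ.+ (c ℕ.+ d) ≡ (a ℕ.+ c) ℕ.+ (b ℕ.+ d)
  interchange = solve-∀

sum-const : ∀ n c → sumℕ n (λ _ → c) ≡ n ℕ.* c
sum-const zero    c = refl
sum-const (suc n) c = cong (c ℕ.+_) (sum-const n c)

-- Fubini for double sums; used to count each edge from both ends.
sum-swap : ∀ m n (f : Fin m → Fin n → ℕ) →
  sumℕ m (λ i → sumℕ n (f i)) ≡ sumℕ n (λ j → sumℕ m (λ i → f i j))
sum-swap zero    n f = ≡-sym (trans (sum-const n 0) (ℕP.*-zeroʳ n))
sum-swap (suc m) n f =
  trans (cong (sumℕ n (f zero) ℕ.+_) (sum-swap m n (λ i → f (suc i))))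
        (≡-sym (sum-+ n (f zero) (λ j → sumℕ m (λ i → f (suc i) j))))

sum-split : ∀ m n (f : Fin (m ℕ.+ n) → ℕ) →
  sumℕ (m ℕ.+ n) f ≡ sumℕ m (λ i → f (i ↑ˡ n)) ℕ.+ sumℕ n (λ j → f (m ↑ʳ j))
sum-split zero    n f = refl
sum-split (suc m) n f =
  trans (cong (f zero ℕ.+_) (sum-split m n (λ i → f (suc i))))
        (≡-sym (ℕP.+-assoc (f zero) _ _))

-- (2) The handshake lemma

<ᵇ-true : ∀ {a b} → a ℕ.< b → (a ℕ.<ᵇ b) ≡ true
<ᵇ-true {a} {b} a<b with a ℕ.<ᵇ b | ℕP.<⇒<ᵇ a<b
... | true | _ = refl

<ᵇ-false : ∀ {a b} → ¬ a ℕ.< b → (a ℕ.<ᵇ b) ≡ false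
<ᵇ-false {a} {b} a≮b with a ℕ.<ᵇ b in eq
... | false = refl
... | true  = ⊥-elim (a≮b (ℕP.<ᵇ⇒< a b (subst T (≡-sym eq) _)))

-- An edge xy is counted in ∣E∣ exactly once: from its smaller endpoint.
edge-once : (G : Graph) (x y : Fin (n G)) →
  b2n (adj G x y)
    ≡ b2n ((toℕ x ℕ.<ᵇ toℕ y) ∧ adj G x y) ℕ.+ b2n ((toℕ y ℕ.<ᵇ toℕ x) ∧ adj G y x)
edge-once G x y rewrite Graph.sym G y x with ℕP.<-cmp (toℕ x) (toℕ y)
... | tri< x<y _ y≮x rewrite <ᵇ-true x<y | <ᵇ-false y≮x = ≡-sym (ℕP.+-identityʳ _)
... | tri> x≮y _ y<x rewrite <ᵇ-true y<x | <ᵇ-false x≮y = refl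
... | tri≈ x≮y x≡y y≮x
  rewrite <ᵇ-false x≮y | <ᵇ-false y≮x | FinP.toℕ-injective x≡y | irrefl G y = refl

handshake : (G : Graph) → sumℕ (n G) (deg G) ≡ 2 ℕ.* ∣E∣ G
handshake G = begin
    sumℕ m (deg G)
  ≡⟨ sum-cong m (λ x → sum-cong m (λ y → edge-once G x y)) ⟩
    sumℕ m (λ x → sumℕ m (λ y → up x y ℕ.+ up y x))
  ≡⟨ sum-cong m (λ x → sum-+ m (up x) (λ y → up y x)) ⟩
    sumℕ m (λ x → sumℕ m (up x) ℕ.+ sumℕ m (λ y → up y x))
  ≡⟨ sum-+ m _ _ ⟩
    ∣E∣ G ℕ.+ sumℕ m (λ x → sumℕ m (λ y → up y x))
  ≡⟨ cong (∣E∣ G ℕ.+_) (≡-sym (sum-swap m m up)) ⟩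
    ∣E∣ G ℕ.+ ∣E∣ G
  ≡⟨ cong (∣E∣ G ℕ.+_) (≡-sym (ℕP.+-identityʳ (∣E∣ G))) ⟩
    2 ℕ.* ∣E∣ G ∎
  where
  open ≡-Reasoning
  m = n G
  up : Fin m → Fin m → ℕ
  up x y = b2n ((toℕ x ℕ.<ᵇ toℕ y) ∧ adj G x y)

-- (3) The binary join A ⊕ B

data Block (m k : ℕ) : Fin (m ℕ.+ k) → Set where
  left  : (a : Fin m) → Block m k (a ↑ˡ k)
  right : (b : Fin k) → Block m k (m ↑ʳ b)

block : ∀ m k (x : Fin (m ℕ.+ k)) → Block m k x
block m k x with splitAt m x in eq
... | inj₁ a = subst (Block m k) (FinP.splitAt⁻¹-↑ˡ eq) (left a)
... | inj₂ b = subst (Block m k) (FinP.splitAt⁻¹-↑ʳ eq) (right b)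

module JoinAdjacency (A B : Graph) where
  adj-ll : (a a′ : Fin (n A)) → adj (A ⊕ B) (a ↑ˡ n B) (a′ ↑ˡ n B) ≡ adj A a a′
  adj-ll a a′ rewrite FinP.splitAt-↑ˡ (n A) a (n B) | FinP.splitAt-↑ˡ (n A) a′ (n B) = refl

  adj-lr : (a : Fin (n A)) (b : Fin (n B)) → adj (A ⊕ B) (a ↑ˡ n B) (n A ↑ʳ b) ≡ true
  adj-lr a b rewrite FinP.splitAt-↑ˡ (n A) a (n B) | FinP.splitAt-↑ʳ (n A) (n B) b = refl

  adj-rl : (a : Fin (n A)) (b : Fin (n B)) → adj (A ⊕ B) (n A ↑ʳ b) (a ↑ˡ n B) ≡ true
  adj-rl a b rewrite FinP.splitAt-↑ˡ (n A) a (n B) | FinP.splitAt-↑ʳ (n A) (n B) b = refl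

  adj-rr : (b b′ : Fin (n B)) → adj (A ⊕ B) (n A ↑ʳ b) (n A ↑ʳ b′) ≡ adj B b b′
  adj-rr b b′ rewrite FinP.splitAt-↑ʳ (n A) (n B) b | FinP.splitAt-↑ʳ (n A) (n B) b′ = refl

open JoinAdjacency

deg-left : (A B : Graph) (a : Fin (n A)) → deg (A ⊕ B) (a ↑ˡ n B) ≡ deg A a ℕ.+ n B ℕ.* 1
deg-left A B a = trans (sum-split (n A) (n B) _)
  (cong₂ ℕ._+_ (sum-cong (n A) (λ a′ → cong b2n (adj-ll A B a a′)))
               (trans (sum-cong (n B) (λ b → cong b2n (adj-lr A B a b))) (sum-const (n B) 1)))

deg-right : (A B : Graph) (b : Fin (n B)) → deg (A ⊕ B) (n A ↑ʳ b) ≡ n A ℕ.* 1 ℕ.+ deg B b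
deg-right A B b = trans (sum-split (n A) (n B) _)
  (cong₂ ℕ._+_ (trans (sum-cong (n A) (λ a → cong b2n (adj-rl A B a b))) (sum-const (n A) 1))
               (sum-cong (n B) (λ b′ → cong b2n (adj-rr A B b b′))))

degreeSum-⊕ : (A B : Graph) → sumℕ (n A ℕ.+ n B) (deg (A ⊕ B))
  ≡ sumℕ (n A) (deg A) ℕ.+ sumℕ (n B) (deg B) ℕ.+ 2 ℕ.* (n A ℕ.* n B)
degreeSum-⊕ A B = begin
    sumℕ (n A ℕ.+ n B) (deg (A ⊕ B))
  ≡⟨ sum-split (n A) (n B) _ ⟩
    sumℕ (n A) (λ a → deg (A ⊕ B) (a ↑ˡ n B)) ℕ.+ sumℕ (n B) (λ b → deg (A ⊕ B) (n A ↑ʳ b))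
  ≡⟨ cong₂ ℕ._+_ (trans (sum-cong (n A) (deg-left A B)) (sum-+ (n A) (deg A) _))
                 (trans (sum-cong (n B) (deg-right A B)) (sum-+ (n B) _ (deg B))) ⟩
    (DA ℕ.+ sumℕ (n A) (λ _ → n B ℕ.* 1)) ℕ.+ (sumℕ (n B) (λ _ → n A ℕ.* 1) ℕ.+ DB)
  ≡⟨ cong₂ (λ s t → (DA ℕ.+ s) ℕ.+ (t ℕ.+ DB))
           (sum-const (n A) (n B ℕ.* 1)) (sum-const (n B) (n A ℕ.* 1)) ⟩
    (DA ℕ.+ n A ℕ.* (n B ℕ.* 1)) ℕ.+ (n B ℕ.* (n A ℕ.* 1) ℕ.+ DB)
  ≡⟨ collect DA DB (n A) (n B) ⟩
    DA ℕ.+ DB ℕ.+ 2 ℕ.* (n A ℕ.* n B) ∎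
  where
  open ≡-Reasoning
  DA = sumℕ (n A) (deg A)
  DB = sumℕ (n B) (deg B)
  collect : ∀ x y p q →
    (x ℕ.+ p ℕ.* (q ℕ.* 1)) ℕ.+ (q ℕ.* (p ℕ.* 1) ℕ.+ y) ≡ x ℕ.+ y ℕ.+ 2 ℕ.* (p ℕ.* q)
  collect = solve-∀

-- (4) Degree sum of G₁ + ⋯ + G_k

order-joinAll : ∀ k (G : Fin k → Graph) → n (joinAll k G) ≡ sumℕ k (λ i → ∣V∣ (G i))
order-joinAll zero    G = refl
order-joinAll (suc k) G = cong (n (G zero) ℕ.+_) (order-joinAll k (λ i → G (suc i)))

degreeSum-joinAll : ∀ k (G : Fin k → Graph) →
  sumℕ (n (joinAll k G)) (deg (joinAll k G)) ℕ.+ sumℕ k (λ i → ∣V∣ (G i) ℕ.* ∣V∣ (G i))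
  ≡ 2 ℕ.* sumℕ k (λ i → ∣E∣ (G i)) ℕ.+ sumℕ k (λ i → ∣V∣ (G i)) ℕ.* sumℕ k (λ i → ∣V∣ (G i))
degreeSum-joinAll zero    G = refl
degreeSum-joinAll (suc k) G = begin
    sumℕ (n₀ ℕ.+ n J) (deg (G zero ⊕ J)) ℕ.+ (n₀ ℕ.* n₀ ℕ.+ Q)
  ≡⟨ cong (ℕ._+ (n₀ ℕ.* n₀ ℕ.+ Q)) (degreeSum-⊕ (G zero) J) ⟩
    (sumℕ n₀ (deg (G zero)) ℕ.+ D ℕ.+ 2 ℕ.* (n₀ ℕ.* n J)) ℕ.+ (n₀ ℕ.* n₀ ℕ.+ Q)
  ≡⟨ cong₂ (λ d s → (d ℕ.+ D ℕ.+ 2 ℕ.* (n₀ ℕ.* s)) ℕ.+ (n₀ ℕ.* n₀ ℕ.+ Q))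
           (handshake (G zero)) (order-joinAll k G′) ⟩
    (2 ℕ.* E₀ ℕ.+ D ℕ.+ 2 ℕ.* (n₀ ℕ.* S)) ℕ.+ (n₀ ℕ.* n₀ ℕ.+ Q)
  ≡⟨ regroup E₀ D Q S n₀ ⟩
    (D ℕ.+ Q) ℕ.+ (2 ℕ.* E₀ ℕ.+ 2 ℕ.* (n₀ ℕ.* S) ℕ.+ n₀ ℕ.* n₀)
  ≡⟨ cong (ℕ._+ (2 ℕ.* E₀ ℕ.+ 2 ℕ.* (n₀ ℕ.* S) ℕ.+ n₀ ℕ.* n₀)) (degreeSum-joinAll k G′) ⟩
    (2 ℕ.* E ℕ.+ S ℕ.* S) ℕ.+ (2 ℕ.* E₀ ℕ.+ 2 ℕ.* (n₀ ℕ.* S) ℕ.+ n₀ ℕ.* n₀)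
  ≡⟨ expand E₀ E S n₀ ⟩
    2 ℕ.* (E₀ ℕ.+ E) ℕ.+ (n₀ ℕ.+ S) ℕ.* (n₀ ℕ.+ S) ∎
  where
  open ≡-Reasoning
  G′ : Fin k → Graph
  G′ i = G (suc i)
  J  = joinAll k G′
  n₀ = n (G zero)
  E₀ = ∣E∣ (G zero)
  D  = sumℕ (n J) (deg J)
  E  = sumℕ k (λ i → ∣E∣ (G′ i))
  S  = sumℕ k (λ i → ∣V∣ (G′ i))
  Q  = sumℕ k (λ i → ∣V∣ (G′ i) ℕ.* ∣V∣ (G′ i))
  regroup : ∀ e₀ d q s m → (2 ℕ.* e₀ ℕ.+ d ℕ.+ 2 ℕ.* (m ℕ.* s)) ℕ.+ (m ℕ.* m ℕ.+ q)
    ≡ (d ℕ.+ q) ℕ.+ (2 ℕ.* e₀ ℕ.+ 2 ℕ.* (m ℕ.* s) ℕ.+ m ℕ.* m)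
  regroup = solve-∀
  expand : ∀ e₀ e s m → (2 ℕ.* e ℕ.+ s ℕ.* s) ℕ.+ (2 ℕ.* e₀ ℕ.+ 2 ℕ.* (m ℕ.* s) ℕ.+ m ℕ.* m)
    ≡ 2 ℕ.* (e₀ ℕ.+ e) ℕ.+ (m ℕ.+ s) ℕ.* (m ℕ.+ s)
  expand = solve-∀

-- (5) Walks, distances and eccentricities

anyFin-true : ∀ m (f : Fin m → Bool) i → f i ≡ true → anyFin m f ≡ true
anyFin-true (suc m) f zero    fi rewrite fi = refl
anyFin-true (suc m) f (suc i) fi
  rewrite anyFin-true m (λ j → f (suc j)) i fi = BoolP.∨-zeroʳ (f zero)

anyFin-false : ∀ m (f : Fin m → Bool) → (∀ i → f i ≡ false) → anyFin m f ≡ false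
anyFin-false zero    f f≡false = refl
anyFin-false (suc m) f f≡false rewrite f≡false zero = anyFin-false m _ (λ i → f≡false (suc i))

module Walks (H : Graph) where
  reach-refl : ∀ u → reach H 0 u u ≡ true
  reach-refl u with u ≟ u
  ... | yes _   = refl
  ... | no  u≢u = ⊥-elim (u≢u refl)

  reach-step : ∀ l u w v → reach H l u w ≡ true → adj H w v ≡ true → reach H (suc l) u v ≡ true
  reach-step l u w v uw wv =
    trans (cong (reach H l u v ∨_) (anyFin-true (n H) _ w (cong₂ _∧_ uw wv)))
          (BoolP.∨-zeroʳ _)

  reach-adj : ∀ u v → adj H u v ≡ true → reach H 1 u v ≡ true
  reach-adj u v = reach-step 0 u u v (reach-refl u)

  reach-via : ∀ u w v → adj H u w ≡ true → adj H w v ≡ true → reach H 2 u v ≡ true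
  reach-via u w v uw = reach-step 1 u w v (reach-adj u w uw)

  reach-adj₂ : ∀ u v → adj H u v ≡ true → reach H 2 u v ≡ true
  reach-adj₂ u v uv rewrite reach-adj u v uv = refl

  reach₀-false : ∀ u v → v ≢ u → reach H 0 u v ≡ false
  reach₀-false u v v≢u with u ≟ v
  ... | yes u≡v = ⊥-elim (v≢u (≡-sym u≡v))
  ... | no  _   = refl

  reach₁-false : ∀ u v → v ≢ u → adj H u v ≡ false → reach H 1 u v ≡ false
  reach₁-false u v v≢u uv rewrite reach₀-false u v v≢u = anyFin-false (n H) _ no-middle
    where
    no-middle : ∀ w → (does (u ≟ w) ∧ adj H w v) ≡ false
    no-middle w with u ≟ w
    ... | yes refl = uv
    ... | no  _    = refl

open Walks

-- The search in dist inspects the radii 0, 1, 2 as soon as there are ≥ 3 vertices.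
dist≤2 : (H : Graph) (u v : Fin (n H)) → 3 ≤ n H → reach H 2 u v ≡ true → dist H u v ≤ 2
dist≤2 record { n = 0 }           _ _ ()
dist≤2 record { n = 1 }           _ _ (s≤s ())
dist≤2 record { n = 2 }           _ _ (s≤s (s≤s ()))
dist≤2 H@record { n = suc (suc (suc _)) } u v _ r₂
  with reach H 0 u v | reach H 1 u v
... | true  | _     = z≤n
... | false | true  = s≤s z≤n
... | false | false rewrite r₂ = s≤s (s≤s z≤n)

dist≡2 : (H : Graph) (u v : Fin (n H)) → 3 ≤ n H →
  reach H 0 u v ≡ false → reach H 1 u v ≡ false → reach H 2 u v ≡ true → dist H u v ≡ 2
dist≡2 record { n = 0 }           _ _ ()
dist≡2 record { n = 1 }           _ _ (s≤s ())
dist≡2 record { n = 2 }           _ _ (s≤s (s≤s ()))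
dist≡2 record { n = suc (suc (suc _)) } u v _ r₀ r₁ r₂ rewrite r₀ | r₁ | r₂ = refl

≤-maxFin : ∀ m (f : Fin m → ℕ) i → f i ≤ maxFin m f
≤-maxFin (suc m) f zero    = ℕP.m≤m⊔n (f zero) _
≤-maxFin (suc m) f (suc i) = ℕP.≤-trans (≤-maxFin m (λ j → f (suc j)) i) (ℕP.m≤n⊔m (f zero) _)

maxFin-≤ : ∀ m (f : Fin m → ℕ) c → (∀ i → f i ≤ c) → maxFin m f ≤ c
maxFin-≤ zero    f c f≤c = z≤n
maxFin-≤ (suc m) f c f≤c = ℕP.⊔-lub (f≤c zero) (maxFin-≤ m (λ j → f (suc j)) c (λ j → f≤c (suc j)))

Undominated : Graph → Set
Undominated H = ∀ v → Σ[ w ∈ Fin (n H) ] (w ≢ v × adj H v w ≡ false)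

-- Diameter ≤ 2 bounds every eccentricity by 2; a non-neighbour attains it.
ecc≡2 : (H : Graph) → 3 ≤ n H → (∀ u w → reach H 2 u w ≡ true) → Undominated H →
  ∀ v → ecc H v ≡ 2
ecc≡2 H 3≤n diam≤2 undominated v with undominated v
... | w , w≢v , vw = ℕP.≤-antisym
  (maxFin-≤ (n H) _ 2 (λ w′ → dist≤2 H v w′ 3≤n (diam≤2 v w′)))
  (subst (_≤ ecc H v)
         (dist≡2 H v w 3≤n (reach₀-false H v w w≢v) (reach₁-false H v w w≢v vw) (diam≤2 v w))
         (≤-maxFin (n H) _ w))

-- (6) The join of k ≥ 2 graphs without well-connected vertices

non-neighbour : (H : Graph) (x : Fin (n H)) → ¬ WellConnected H x →
  Σ[ y ∈ Fin (n H) ] (y ≢ x × adj H x y ≡ false)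
non-neighbour H x not-wc with FinP.¬∀⟶∃¬ (n H) Covered covered? (λ all → not-wc (toWC all))
  where
  Covered : Fin (n H) → Set
  Covered y = y ≡ x ⊎ adj H x y ≡ true
  covered? : ∀ y → Dec (Covered y)
  covered? y = (y ≟ x) ⊎-dec (adj H x y BoolP.≟ true)
  toWC : (∀ y → Covered y) → WellConnected H x
  toWC all y y≢x with all y
  ... | inj₁ y≡x = ⊥-elim (y≢x y≡x)
  ... | inj₂ xy  = xy
... | y , uncovered = y , (λ y≡x → uncovered (inj₁ y≡x)) , BoolP.¬-not (λ xy → uncovered (inj₂ xy))

undominated-⊕ : (A B : Graph) → Undominated A → Undominated B → Undominated (A ⊕ B)
undominated-⊕ A B undomA undomB v with block (n A) (n B) v
... | left a with undomA a
...   | y , y≢a , ay = y ↑ˡ n B , (λ eq → y≢a (FinP.↑ˡ-injective _ y a eq)) , trans (adj-ll A B a y) ay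
undominated-⊕ A B undomA undomB v | right b with undomB b
...   | y , y≢b , by = n A ↑ʳ y , (λ eq → y≢b (FinP.↑ʳ-injective _ y b eq)) , trans (adj-rr A B b y) by

undominated-joinAll : ∀ k (G : Fin k → Graph) → (∀ i x → ¬ WellConnected (G i) x) →
  Undominated (joinAll k G)
undominated-joinAll zero    G noWC ()
undominated-joinAll (suc k) G noWC = undominated-⊕ (G zero) (joinAll k (λ i → G (suc i)))
  (λ x → non-neighbour (G zero) x (noWC zero x))
  (undominated-joinAll k (λ i → G (suc i)) (λ i → noWC (suc i)))

-- The join of two nonempty graphs has diameter ≤ 2: non-adjacent vertices of
-- one block have a common neighbour in the other block.
diameter-⊕ : (A B : Graph) → Fin (n A) → Fin (n B) → ∀ u w → reach (A ⊕ B) 2 u w ≡ true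
diameter-⊕ A B a₀ b₀ u w with block (n A) (n B) u | block (n A) (n B) w
... | left a  | right b = reach-adj₂ (A ⊕ B) _ _ (adj-lr A B a b)
... | right b | left a  = reach-adj₂ (A ⊕ B) _ _ (adj-rl A B a b)
... | left a  | left a′ with adj A a a′ in aa′
...   | true  = reach-adj₂ (A ⊕ B) _ _ (trans (adj-ll A B a a′) aa′)
...   | false = reach-via (A ⊕ B) _ (n A ↑ʳ b₀) _ (adj-lr A B a b₀) (adj-rl A B a′ b₀)
diameter-⊕ A B a₀ b₀ u w | right b | right b′ with adj B b b′ in bb′
...   | true  = reach-adj₂ (A ⊕ B) _ _ (trans (adj-rr A B b b′) bb′)
...   | false = reach-via (A ⊕ B) _ (a₀ ↑ˡ n B) _ (adj-rl A B a₀ b) (adj-lr A B a₀ b′)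

two≤order : (H : Graph) → 1 ≤ n H → (∀ x → ¬ WellConnected H x) → 2 ≤ n H
two≤order record { n = suc zero }    _ noWC = ⊥-elim (noWC zero λ { zero 0≢0 → ⊥-elim (0≢0 refl) })
two≤order record { n = suc (suc _) } _ _    = s≤s (s≤s z≤n)

vertex : ∀ {m} → 1 ≤ m → Fin m
vertex {suc _} _ = zero

ecc-joinAll : ∀ k (G : Fin (suc (suc k)) → Graph) → (∀ i → 1 ≤ ∣V∣ (G i)) →
  (∀ i x → ¬ WellConnected (G i) x) → ∀ v → ecc (joinAll (suc (suc k)) G) v ≡ 2
ecc-joinAll k G nonempty noWC = ecc≡2 (A ⊕ B)
  (ℕP.+-mono-≤ (two≤order A (nonempty zero) (noWC zero)) 1≤nB)
  (diameter-⊕ A B (vertex (nonempty zero)) (vertex 1≤nB))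
  (undominated-joinAll (suc (suc k)) G noWC)
  where
  A = G zero
  B = joinAll (suc k) (λ i → G (suc i))
  1≤nB : 1 ≤ n B
  1≤nB = ℕP.≤-trans (nonempty (suc zero)) (ℕP.m≤m+n _ _)

-- (7) From ℕ to ℚ

ι : ℕ → ℚ
ι m = + m / 1

half : ℚ
half = + 1 / 2

-- Equalities in ℚ are checked on unnormalised representatives.
≡-viaℚᵘ : ∀ {p q x} → toℚᵘ p ≃ x → toℚᵘ q ≃ x → p ≡ q
≡-viaℚᵘ p≃x q≃x = ℚP.toℚᵘ-injective (ℚᵘP.≃-trans p≃x (ℚᵘP.≃-sym q≃x))

toℚᵘ-/ : ∀ a d → toℚᵘ (+ a / suc d) ≃ mkℚᵘ (+ a) d
toℚᵘ-/ a d = ℚP.toℚᵘ-fromℚᵘ (mkℚᵘ (+ a) d)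

ι-+ : ∀ a b → ι (a ℕ.+ b) ≡ ι a + ι b
ι-+ a b = ≡-viaℚᵘ (toℚᵘ-/ (a ℕ.+ b) 0)
  (ℚᵘP.≃-trans (ℚP.toℚᵘ-homo-+ (ι a) (ι b))
  (ℚᵘP.≃-trans (ℚᵘP.+-cong (toℚᵘ-/ a 0) (toℚᵘ-/ b 0))
  (*≡* (trans (numerator (+ a) (+ b)) (cong (ℤ._* + 1) (≡-sym (ℤP.pos-+ a b)))))))
  where
  numerator : ∀ x y → (x ℤ.* + 1 ℤ.+ y ℤ.* + 1) ℤ.* + 1 ≡ (x ℤ.+ y) ℤ.* + 1
  numerator = ℤSolver.solve-∀

ι-* : ∀ a b → ι (a ℕ.* b) ≡ ι a * ι b
ι-* a b = ≡-viaℚᵘ (toℚᵘ-/ (a ℕ.* b) 0)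
  (ℚᵘP.≃-trans (ℚP.toℚᵘ-homo-* (ι a) (ι b))
  (ℚᵘP.≃-trans (ℚᵘP.*-cong (toℚᵘ-/ a 0) (toℚᵘ-/ b 0))
  (*≡* (cong (ℤ._* + 1) (≡-sym (ℤP.pos-* a b))))))

/2≡half* : ∀ a → + a / 2 ≡ half * ι a
/2≡half* a = ≡-viaℚᵘ (toℚᵘ-/ a 1)
  (ℚᵘP.≃-trans (ℚP.toℚᵘ-homo-* half (ι a))
  (ℚᵘP.≃-trans (ℚᵘP.*-cong (toℚᵘ-/ 1 1) (toℚᵘ-/ a 0))
  (*≡* (cong (ℤ._* + 2) (ℤP.*-identityˡ (+ a))))))

sumℚ-cong : ∀ m {f g : Fin m → ℚ} → (∀ i → f i ≡ g i) → sumℚ m f ≡ sumℚ m g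
sumℚ-cong zero    f≡g = refl
sumℚ-cong (suc m) f≡g = cong₂ _+_ (f≡g zero) (sumℚ-cong m (λ i → f≡g (suc i)))

sumℚ-ι : ∀ m (f : Fin m → ℕ) → sumℚ m (λ i → ι (f i)) ≡ ι (sumℕ m f)
sumℚ-ι zero    f = refl
sumℚ-ι (suc m) f = trans (cong (λ t → ι (f zero) + t) (sumℚ-ι m (λ i → f (suc i))))
                         (≡-sym (ι-+ (f zero) _))

sumℚ-scale : ∀ m c (f : Fin m → ℚ) → sumℚ m (λ i → c * f i) ≡ c * sumℚ m f
sumℚ-scale zero    c f = ≡-sym (ℚP.*-zeroʳ c)
sumℚ-scale (suc m) c f = trans (cong (λ t → c * f zero + t) (sumℚ-scale m c (λ i → f (suc i))))
                               (≡-sym (ℚP.*-distribˡ-+ c (f zero) _))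

Cξ-eccentricity-2 : (H : Graph) → (∀ v → ecc H v ≡ 2) → Cξ H ≡ half * ι (sumℕ (n H) (deg H))
Cξ-eccentricity-2 H ecc≡2 = begin
    sumℚ (n H) (λ v → frac (deg H v) (ecc H v))
  ≡⟨ sumℚ-cong (n H) (λ v → trans (cong (frac (deg H v)) (ecc≡2 v)) (/2≡half* (deg H v))) ⟩
    sumℚ (n H) (λ v → half * ι (deg H v))
  ≡⟨ sumℚ-scale (n H) half _ ⟩
    half * sumℚ (n H) (λ v → ι (deg H v))
  ≡⟨ cong (half *_) (sumℚ-ι (n H) (deg H)) ⟩
    half * ι (sumℕ (n H) (deg H)) ∎
  where open ≡-Reasoning

sum-squaresℚ : ∀ m (f : Fin m → ℕ) → ι (sumℕ m (λ i → f i ℕ.* f i)) ≡ sumℚ m (λ i → ι (f i) * ι (f i))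
sum-squaresℚ m f = trans (≡-sym (sumℚ-ι m (λ i → f i ℕ.* f i))) (sumℚ-cong m (λ i → ι-* (f i) (f i)))

degreeSumℚ-joinAll : ∀ k (G : Fin k → Graph) →
  ι (sumℕ (n (joinAll k G)) (deg (joinAll k G))) + ι (sumℕ k (λ i → ∣V∣ (G i) ℕ.* ∣V∣ (G i)))
  ≡ ι (sumℕ k (λ i → ∣E∣ (G i))) + ι (sumℕ k (λ i → ∣E∣ (G i)))
    + ι (sumℕ k (λ i → ∣V∣ (G i))) * ι (sumℕ k (λ i → ∣V∣ (G i)))
degreeSumℚ-joinAll k G = begin
    ι D + ι Q                  ≡⟨ ≡-sym (ι-+ D Q) ⟩
    ι (D ℕ.+ Q)                ≡⟨ cong ι (degreeSum-joinAll k G) ⟩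
    ι (2 ℕ.* E ℕ.+ S ℕ.* S)    ≡⟨ ι-+ (2 ℕ.* E) (S ℕ.* S) ⟩
    ι (2 ℕ.* E) + ι (S ℕ.* S)  ≡⟨ cong₂ _+_ (ι-double E) (ι-* S S) ⟩
    ι E + ι E + ι S * ι S      ∎
  where
  open ≡-Reasoning
  D = sumℕ (n (joinAll k G)) (deg (joinAll k G))
  Q = sumℕ k (λ i → ∣V∣ (G i) ℕ.* ∣V∣ (G i))
  E = sumℕ k (λ i → ∣E∣ (G i))
  S = sumℕ k (λ i → ∣V∣ (G i))
  ι-double : ∀ m → ι (2 ℕ.* m) ≡ ι m + ι m
  ι-double m = trans (cong (λ t → ι (m ℕ.+ t)) (ℕP.+-identityʳ m)) (ι-+ m m)

halve : ∀ d q e s → d + q ≡ e + e + s * s → half * d ≡ e + half * (s * s) - half * q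
halve d q e s d+q≡ = begin
    half * d                          ≡⟨ add-and-subtract d q ⟩
    half * (d + q) - half * q         ≡⟨ cong (λ t → half * t - half * q) d+q≡ ⟩
    half * (e + e + s * s) - half * q ≡⟨ halve-double e s q ⟩
    e + half * (s * s) - half * q     ∎
  where
  open ≡-Reasoning
  open +-*-Solver
  add-and-subtract : ∀ d q → half * d ≡ half * (d + q) - half * q
  add-and-subtract = solve 2 (λ d q → con half :* d := con half :* (d :+ q) :- con half :* q) refl
  halve-double : ∀ e s q → half * (e + e + s * s) - half * q ≡ e + half * (s * s) - half * q
  halve-double = solve 3 (λ e s q →
    con half :* (e :+ e :+ s :* s) :- con half :* q := e :+ con half :* (s :* s) :- con half :* q) refl

theorem4 : (k : ℕ) → 2 ≤ k → (G : Fin k → Graph)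
    → (∀ i → 1 ≤ ∣V∣ (G i))
    → (∀ i → (x : Fin (∣V∣ (G i))) → ¬ WellConnected (G i) x)
    → Cξ (joinAll k G)
      ≡ (+ sumℕ k (λ i → ∣E∣ (G i)) / 1)
        + (+ 1 / 2) * ((+ sumℕ k (λ i → ∣V∣ (G i)) / 1) * (+ sumℕ k (λ i → ∣V∣ (G i)) / 1))
        - (+ 1 / 2) * sumℚ k (λ i → (+ ∣V∣ (G i) / 1) * (+ ∣V∣ (G i) / 1))
theorem4 (suc zero) (s≤s ()) G _ _
theorem4 (suc (suc k)) _ G nonempty noWC = begin
    Cξ J
  ≡⟨ Cξ-eccentricity-2 J (ecc-joinAll k G nonempty noWC) ⟩
    half * ι (sumℕ (n J) (deg J))
  ≡⟨ halve (ι (sumℕ (n J) (deg J))) (ι Q) (ι E) (ι S) (degreeSumℚ-joinAll K G) ⟩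
    ι E + half * (ι S * ι S) - half * ι Q
  ≡⟨ cong (λ t → ι E + half * (ι S * ι S) - half * t) (sum-squaresℚ K (λ i → ∣V∣ (G i))) ⟩
    ι E + half * (ι S * ι S) - half * sumℚ K (λ i → ι (∣V∣ (G i)) * ι (∣V∣ (G i))) ∎
  where
  open ≡-Reasoning
  K = suc (suc k)
  J = joinAll K G
  E = sumℕ K (λ i → ∣E∣ (G i))
  S = sumℕ K (λ i → ∣V∣ (G i))
  Q = sumℕ K (λ i → ∣V∣ (G i) ℕ.* ∣V∣ (G i))
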